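{- For every Rec statement $S$ (relative to a procedure table $T$) without statement variables and every closed trace formula $\phi$, if the judgment $S:\phi$ is valid (i.e. $\mathcal{S}_{tr}[\![S]\!]\subseteq[\![\phi]\!]$), then the sequent $\vdash S:\phi$ (empty antecedent) is derivable in the proof calculus, relative to an oracle deciding the entailments $\phi'\models\phi$ used by rule (Cons).
   Context: Rec statements: $S ::= \mathbf{skip} \mid x := a \mid S_1;S_2 \mid \mathbf{if}\ b\ \mathbf{then}\ S_1\ \mathbf{else}\ S_2 \mid m() \mid Y$, with $a,b$ side-effect-free arithmetic/Boolean expressions over global integer variables, $m$ procedures declared in $T$ (declarations $m\,\{S_m\}$, unique names), $Y$ statement variables; each procedure $m$ has an associated statement variable $Y_m$. $\mathbf{State}$ = maps from variables to $\mathbb{Z}$, $\mathbf{State}^+$ = nonempty finite state sequences. Trace semantics of statements without statement variables: $A|_b=\{s\cdot\sigma\in A:\mathcal{B}[\![b]\!](s)=\mathbf{tt}\}$, $\sharp A=\{s\cdot s\cdot\sigma:s\cdot\sigma\in A\}$, $A\frown B=\{\sigma_A\cdot s\cdot\sigma_B:\sigma_A\cdot s\in A,s\cdot\sigma_B\in B\}$; $\mathcal{S}_{tr}[\![\mathbf{skip}]\!]_\rho=\{s\cdot s\}$, $\mathcal{S}_{tr}[\![x:=a]\!]_\rho=\{s\cdot s[x\mapsto\mathcal{A}[\![a]\!](s)]\}$, sequencing is $\frown$, $\mathcal{S}_{tr}[\![\mathbf{if}\ b\ \mathbf{then}\ S_1\ \mathbf{else}\ S_2]\!]_\rho=(\sharp\mathcal{S}_{tr}[\![S_1]\!]_\rho)|_b\cup(\sharp\mathcal{S}_{tr}[\![S_2]\!]_\rho)|_{\neg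 b}$, $\mathcal{S}_{tr}[\![m()]\!]_\rho=\rho(m)$; $\rho_0$ = least fixed point of $\rho\mapsto(\sharp\mathcal{S}_{tr}[\![S_m]\!]_\rho)_m$, $\mathcal{S}_{tr}[\![S]\!]=\mathcal{S}_{tr}[\![S]\!]_{\rho_0}$. Trace formulas: $\phi ::= p \mid R \mid X \mid \phi_1\wedge\phi_2 \mid \phi_1\vee\phi_2 \mid \phi_1\frown\phi_2 \mid \mu X.\phi$ with $[\![p]\!]=\{s\cdot\sigma:s\models p\}$ (state formulas include Boolean expressions), $[\![R]\!]=\{s\cdot s':R(s,s')\}$, $\wedge,\vee,\frown$ as $\cap,\cup$, chop, $\mu$ as least fixed point; $\mathit{Id}$: $s'=s$; $\mathit{Sb}^a_x$: $s'=s[x\mapsto\mathcal{A}[\![a]\!](s)]$; $\phi'\models\phi$ iff $[\![\phi']\!]\subseteq[\![\phi]\!]$. Proof calculus: sequents $\Gamma\vdash S:\phi$ ($\Gamma$ a finite set of judgments, $\phi$ closed). Rules: (Skip) $\Gamma\vdash\mathbf{skip}:\mathit{Id}$; (Assign) $\Gamma\vdash x:=a:\mathit{Sb}^a_x$; (Seq) from $\Gamma\vdash S_1:\phi_1$, $\Gamma\vdash S_2:\phi_2$ infer $\Gamma\vdash S_1;S_2:\phi_1\frown\phi_2$; (If) from $\Gamma\vdash\mathbf{skip};S_1:\neg b\vee\phi$ and $\Gamma\vdash\mathbf{skip};S_2:b\vee\phi$ infer $\Gamma\vdash\mathbf{if}\ b\ \mathbf{then}\ S_1\ \mathbf{else}\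 S_2:\phi$; (Unfold) from $\Gamma\vdash S:\phi[\mu X.\phi/X]$ infer $\Gamma\vdash S:\mu X.\phi$; (Cons) from $\Gamma\vdash S:\phi'$ infer $\Gamma\vdash S:\phi$ when $\phi'\models\phi$; (Call) if $Y_m:\phi_m\notin\Gamma$ and $m\,\{S_m\}\in T$, from $\Gamma,Y_m:\phi_m\vdash S_m[\mathbf{skip};Y_m/m(),\mathbf{skip};Y_{m_1}/m_1(),\dots]:\phi_m$ (substituting for all procedures $m_i$ with $Y_{m_i}:\phi_{m_i}\in\Gamma$) infer $\Gamma\vdash m():\mathit{Id}\frown\phi_m$; plus standard Gentzen-style logical rules, including the axiom $\Gamma\vdash S:\phi$ for $S:\phi\in\Gamma$. -}

module Defs where

open import Level using (Level; _⊔_) renaming (suc to lsuc; zero to lzero)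
open import Data.Nat using (ℕ; _≟_)
open import Data.Integer using (ℤ) renaming (_+_ to _+ℤ_; _-_ to _-ℤ_; _*_ to _*ℤ_; _≤ᵇ_ to _≤ᵇℤ_)
import Data.Integer as ℤ
open import Data.Bool using (Bool; true; false; not; _∧_; _∨_; if_then_else_)
open import Data.Fin using (Fin)
open import Data.List using (List; []; _∷_)
open import Data.List.NonEmpty using (List⁺; _∷_; _∷ʳ_; _++⁺_; head)
open import Data.List.Membership.Propositional using (_∈_)
open import Data.Product using (Σ; ∃; _×_; _,_)
open import Relation.Nullary using (¬_; does)
open import Relation.Binary.PropositionalEquality using (_≡_)

Var : Set
Var = ℕ

State : Set
State = Var → ℤ

_[_↦_] : State → Var → ℤ → State
(s [ x ↦ v ]) y = if does (x ≟ y) then v else s y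

Trace : Set
Trace = List⁺ State

TraceSet : ∀ ℓ → Set (lsuc ℓ)
TraceSet ℓ = Trace → Set ℓ

data AExp : Set where
  num          : ℤ → AExp
  var          : Var → AExp
  _⊕_ _⊖_ _⊗_  : AExp → AExp → AExp

data BExp : Set where
  tt ff     : BExp
  _≤ₑ_ _≡ₑ_ : AExp → AExp → BExp
  ¬ₑ_       : BExp → BExp
  _∧ₑ_ _∨ₑ_ : BExp → BExp → BExp

𝒜⟦_⟧ : AExp → State → ℤ
𝒜⟦ num n ⟧ s = n
𝒜⟦ var x ⟧ s = s x
𝒜⟦ a ⊕ b ⟧ s = 𝒜⟦ a ⟧ s +ℤ 𝒜⟦ b ⟧ s
𝒜⟦ a ⊖ b ⟧ s = 𝒜⟦ a ⟧ s -ℤ 𝒜⟦ b ⟧ s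
𝒜⟦ a ⊗ b ⟧ s = 𝒜⟦ a ⟧ s *ℤ 𝒜⟦ b ⟧ s

ℬ⟦_⟧ : BExp → State → Bool
ℬ⟦ tt ⟧ s = true
ℬ⟦ ff ⟧ s = false
ℬ⟦ a ≤ₑ b ⟧ s = 𝒜⟦ a ⟧ s ≤ᵇℤ 𝒜⟦ b ⟧ s
ℬ⟦ a ≡ₑ b ⟧ s = does (𝒜⟦ a ⟧ s ℤ.≟ 𝒜⟦ b ⟧ s)
ℬ⟦ ¬ₑ b ⟧ s = not (ℬ⟦ b ⟧ s)
ℬ⟦ b ∧ₑ c ⟧ s = ℬ⟦ b ⟧ s ∧ ℬ⟦ c ⟧ s
ℬ⟦ b ∨ₑ c ⟧ s = ℬ⟦ b ⟧ s ∨ ℬ⟦ c ⟧ s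

-- Rec statements over k procedures (named by Fin k).  Statement
-- variable Y m is the variable Y_m associated with procedure m.

data Stmt (k : ℕ) : Set where
  skip         : Stmt k
  _≔_          : Var → AExp → Stmt k
  _；_         : Stmt k → Stmt k → Stmt k
  IF_THEN_ELSE_ : BExp → Stmt k → Stmt k → Stmt k
  call         : Fin k → Stmt k
  Y            : Fin k → Stmt k

-- A procedure table T: every m has exactly one declaration m { T m }.
Table : ℕ → Set
Table k = Fin k → Stmt k

data NoSVar {k : ℕ} : Stmt k → Set where
  skip : NoSVar skip
  asg  : ∀ {x a} → NoSVar (x ≔ a)
  seq  : ∀ {S₁ S₂} → NoSVar S₁ → NoSVar S₂ → NoSVar (S₁ ； S₂)
  ite  : ∀ {b S₁ S₂} → NoSVar S₁ → NoSVar S₂ → NoSVar (IF b THEN S₁ ELSE S₂)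
  call : ∀ {m} → NoSVar (call m)

_∣_ : ∀ {ℓ} → TraceSet ℓ → BExp → TraceSet ℓ
(A ∣ b) (s ∷ σ) = A (s ∷ σ) × ℬ⟦ b ⟧ s ≡ true

♯ : ∀ {ℓ} → TraceSet ℓ → TraceSet ℓ
♯ A t = Σ State λ s → Σ (List State) λ σ → t ≡ (s ∷ (s ∷ σ)) × A (s ∷ σ)

_⁀_ : ∀ {ℓ} → TraceSet ℓ → TraceSet ℓ → TraceSet ℓ
(A ⁀ B) t = Σ (List State) λ σA → Σ State λ s → Σ (List State) λ σB →
            t ≡ (σA ++⁺ (s ∷ σB)) × A (σA ∷ʳ s) × B (s ∷ σB)

-- The procedure environment ρ₀ is the least fixed point of
-- ρ ↦ (♯ 𝒮tr⟦ S_m ⟧ρ)_m; it is given here as an inductive definition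
-- (inductive types are least fixed points), where a call m()
-- contributes ♯ 𝒮tr⟦ T m ⟧.

data 𝒮tr⟦_⟧ {k : ℕ} (T : Table k) : Stmt k → TraceSet lzero where
  skip : ∀ {s} → 𝒮tr⟦ T ⟧ skip (s ∷ s ∷ [])
  asg  : ∀ {x a s} → 𝒮tr⟦ T ⟧ (x ≔ a) (s ∷ (s [ x ↦ 𝒜⟦ a ⟧ s ]) ∷ [])
  seq  : ∀ {S₁ S₂ t} → (𝒮tr⟦ T ⟧ S₁ ⁀ 𝒮tr⟦ T ⟧ S₂) t → 𝒮tr⟦ T ⟧ (S₁ ； S₂) t
  ifT  : ∀ {b S₁ S₂ t} → ((♯ (𝒮tr⟦ T ⟧ S₁)) ∣ b) t → 𝒮tr⟦ T ⟧ (IF b THEN S₁ ELSE S₂) t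
  ifF  : ∀ {b S₁ S₂ t} → ((♯ (𝒮tr⟦ T ⟧ S₂)) ∣ (¬ₑ b)) t → 𝒮tr⟦ T ⟧ (IF b THEN S₁ ELSE S₂) t
  call : ∀ {m t} → ♯ (𝒮tr⟦ T ⟧ (T m)) t → 𝒮tr⟦ T ⟧ (call m) t

-- Trace formulas (named fixpoint variables X ∈ ℕ).
-- State formulas p and relations R are taken semantically.

FVar : Set
FVar = ℕ

data Formula : Set₁ where
  st   : (State → Set) → Formula
  rel  : (State → State → Set) → Formula
  fv   : FVar → Formula
  _∧ᶠ_ _∨ᶠ_ _⁀ᶠ_ : Formula → Formula → Formula
  μ    : FVar → Formula → Formula

⌜_⌝ : BExp → Formula
⌜ b ⌝ = st (λ s → ℬ⟦ b ⟧ s ≡ true)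

Id : Formula
Id = rel (λ s s′ → s′ ≡ s)

Sb : Var → AExp → Formula
Sb x a = rel (λ s s′ → s′ ≡ s [ x ↦ 𝒜⟦ a ⟧ s ])

data Scoped (vs : List FVar) : Formula → Set₁ where
  st  : ∀ {p} → Scoped vs (st p)
  rel : ∀ {R} → Scoped vs (rel R)
  fv  : ∀ {X} → X ∈ vs → Scoped vs (fv X)
  and : ∀ {φ ψ} → Scoped vs φ → Scoped vs ψ → Scoped vs (φ ∧ᶠ ψ)
  or  : ∀ {φ ψ} → Scoped vs φ → Scoped vs ψ → Scoped vs (φ ∨ᶠ ψ)
  chp : ∀ {φ ψ} → Scoped vs φ → Scoped vs ψ → Scoped vs (φ ⁀ᶠ ψ)
  mu  : ∀ {X φ} → Scoped (X ∷ vs) φ → Scoped vs (μ X φ)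

Closed : Formula → Set₁
Closed = Scoped []

-- substitution φ[ψ/X] (capture-free when ψ is closed, the only use)
_[_/_] : Formula → Formula → FVar → Formula
st p [ ψ / X ] = st p
rel R [ ψ / X ] = rel R
fv Z [ ψ / X ] = if does (X ≟ Z) then ψ else fv Z
(φ₁ ∧ᶠ φ₂) [ ψ / X ] = (φ₁ [ ψ / X ]) ∧ᶠ (φ₂ [ ψ / X ])
(φ₁ ∨ᶠ φ₂) [ ψ / X ] = (φ₁ [ ψ / X ]) ∨ᶠ (φ₂ [ ψ / X ])
(φ₁ ⁀ᶠ φ₂) [ ψ / X ] = (φ₁ [ ψ / X ]) ⁀ᶠ (φ₂ [ ψ / X ])
μ Z φ [ ψ / X ] = if does (X ≟ Z) then μ Z φ else μ Z (φ [ ψ / X ])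

-- Semantics ⟦φ⟧ of closed formulas.  ∧,∨,⁀ are ∩,∪,chop; μX.φ is the
-- least fixed point, given inductively (least set closed under
-- unfolding φ[μX.φ/X] ⊆ μX.φ).  Free variables have no constructor.
data ⟦_⟧ : Formula → TraceSet (lsuc lzero) where
  st   : ∀ {p s σ} → p s → ⟦ st p ⟧ (s ∷ σ)
  rel  : ∀ {R s s′} → R s s′ → ⟦ rel R ⟧ (s ∷ s′ ∷ [])
  and  : ∀ {φ ψ t} → ⟦ φ ⟧ t → ⟦ ψ ⟧ t → ⟦ φ ∧ᶠ ψ ⟧ t
  orl  : ∀ {φ ψ t} → ⟦ φ ⟧ t → ⟦ φ ∨ᶠ ψ ⟧ t
  orr  : ∀ {φ ψ t} → ⟦ ψ ⟧ t → ⟦ φ ∨ᶠ ψ ⟧ t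
  chp  : ∀ {φ ψ t} → (⟦ φ ⟧ ⁀ ⟦ ψ ⟧) t → ⟦ φ ⁀ᶠ ψ ⟧ t
  mu   : ∀ {X φ t} → ⟦ φ [ μ X φ / X ] ⟧ t → ⟦ μ X φ ⟧ t

-- semantic entailment φ′ ⊨ φ (the oracle used by rule Cons)
_⊨_ : Formula → Formula → Set₁
φ′ ⊨ φ = ∀ t → ⟦ φ′ ⟧ t → ⟦ φ ⟧ t

-- antecedents: finite sets of judgments Y_m : φ_m
Ctx : ℕ → Set₁
Ctx k = List (Fin k × Formula)

Assumed : ∀ {k} → Ctx k → Fin k → Set₁
Assumed Γ m = Σ Formula λ φ → (m , φ) ∈ Γ

-- S[skip;Y_mᵢ / mᵢ()] for all mᵢ satisfying P  (as a relation)
data Repl {k : ℕ} (P : Fin k → Set₁) : Stmt k → Stmt k → Set₁ where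
  skip  : Repl P skip skip
  asg   : ∀ {x a} → Repl P (x ≔ a) (x ≔ a)
  seq   : ∀ {S₁ S₂ S₁′ S₂′} → Repl P S₁ S₁′ → Repl P S₂ S₂′ → Repl P (S₁ ； S₂) (S₁′ ； S₂′)
  ite   : ∀ {b S₁ S₂ S₁′ S₂′} → Repl P S₁ S₁′ → Repl P S₂ S₂′ →
          Repl P (IF b THEN S₁ ELSE S₂) (IF b THEN S₁′ ELSE S₂′)
  callY : ∀ {m} → P m → Repl P (call m) (skip ； Y m)
  callN : ∀ {m} → ¬ (P m) → Repl P (call m) (call m)
  var   : ∀ {m} → Repl P (Y m) (Y m)

data _⨾_⊢_∶_ {k : ℕ} (T : Table k) (Γ : Ctx k) : Stmt k → Formula → Set₁ where
  Skip   : T ⨾ Γ ⊢ skip ∶ Id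
  Assign : ∀ {x a} → T ⨾ Γ ⊢ (x ≔ a) ∶ Sb x a
  Seq    : ∀ {S₁ S₂ φ₁ φ₂} → T ⨾ Γ ⊢ S₁ ∶ φ₁ → T ⨾ Γ ⊢ S₂ ∶ φ₂ → T ⨾ Γ ⊢ (S₁ ； S₂) ∶ (φ₁ ⁀ᶠ φ₂)
  If     : ∀ {b S₁ S₂ φ} → T ⨾ Γ ⊢ (skip ； S₁) ∶ (⌜ ¬ₑ b ⌝ ∨ᶠ φ) → T ⨾ Γ ⊢ (skip ； S₂) ∶ (⌜ b ⌝ ∨ᶠ φ) →
           T ⨾ Γ ⊢ (IF b THEN S₁ ELSE S₂) ∶ φ
  Unfold : ∀ {S X φ} → T ⨾ Γ ⊢ S ∶ (φ [ μ X φ / X ]) → T ⨾ Γ ⊢ S ∶ μ X φ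
  Cons   : ∀ {S φ′ φ} → Closed φ′ → φ′ ⊨ φ → T ⨾ Γ ⊢ S ∶ φ′ → T ⨾ Γ ⊢ S ∶ φ
  Call   : ∀ {m φₘ} {Sₘ′ : Stmt k} → Closed φₘ → ¬ ((m , φₘ) ∈ Γ) →
           Repl (Assumed ((m , φₘ) ∷ Γ)) (T m) Sₘ′ →
           T ⨾ ((m , φₘ) ∷ Γ) ⊢ Sₘ′ ∶ φₘ →
           T ⨾ Γ ⊢ call m ∶ (Id ⁀ᶠ φₘ)
  Ax     : ∀ {m φ} → (m , φ) ∈ Γ → T ⨾ Γ ⊢ Y m ∶ φ
  AndR   : ∀ {S φ ψ} → T ⨾ Γ ⊢ S ∶ φ → T ⨾ Γ ⊢ S ∶ ψ → T ⨾ Γ ⊢ S ∶ (φ ∧ᶠ ψ)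
  OrR₁   : ∀ {S φ ψ} → T ⨾ Γ ⊢ S ∶ φ → T ⨾ Γ ⊢ S ∶ (φ ∨ᶠ ψ)
  OrR₂   : ∀ {S φ ψ} → T ⨾ Γ ⊢ S ∶ ψ → T ⨾ Γ ⊢ S ∶ (φ ∨ᶠ ψ)

-- Completeness through strongest formulas.  Every statement S gets a characteristic
-- trace formula χ S that mirrors the trace semantics clause by clause: ⟦ χ S ⟧ is
-- contained in 𝒮tr⟦ S ⟧, and S : χ S is derivable.  Validity of S : φ then gives
-- χ S ⊨ φ, and a single application of (Cons) concludes.  A call of a procedure m that
-- is not yet assumed becomes μX_m.χ(S_m), where recursive calls of m inside S_m refer to
-- X_m; rule (Call) assumes exactly this formula for Y_m, so calls of assumed procedures
-- are closed off by the axiom.  Every (Call) assumes a new procedure, so the nesting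
-- depth, and with it the recursion defining χ, is bounded by the number of procedures.
module Submission where

open import Defs
open import Data.Nat using (ℕ)
open import Data.List using ([])

open import Data.Nat using (zero; suc; _≤_; s≤s⁻¹)
import Data.Nat as ℕ
open import Data.Nat.Properties using (≤-refl; ≤-trans)
open import Data.Fin using (Fin; toℕ; _≟_)
open import Data.Fin.Properties using (toℕ-injective)
open import Data.List using (List; _∷_; length; allFin; filter)
open import Data.List.Properties using (filter-notAll)
open import Data.List.NonEmpty using (_∷_; _∷ʳ_; _++⁺_)
open import Data.List.Membership.Propositional using (_∈_; _∉_)
open import Data.List.Membership.Propositional.Properties using (∈-filter⁺; ∈-filter⁻; ∈-allFin)
open import Data.List.Relation.Binary.Subset.Propositional using (_⊆_)
open import Data.List.Relation.Binary.Subset.Propositional.Properties using (∷⁺ʳ; xs⊆x∷xs)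
open import Data.List.Relation.Unary.Any using (here; there)
import Data.List.Relation.Unary.Any as Any
open import Data.Product using (Σ; _×_; _,_; proj₁; proj₂)
open import Data.Sum using (_⊎_; inj₁; inj₂)
open import Data.Empty using (⊥)
open import Data.Bool using (true; false; not; if_then_else_)
open import Function using (const)
open import Relation.Nullary using (¬_; Dec; yes; no; does; ¬?; contradiction)
open import Relation.Nullary.Decidable using (dec-true; dec-false)
open import Relation.Binary.PropositionalEquality using (_≡_; _≢_; refl; sym; trans; cong; cong₂; subst)

fv-[/]-self : ∀ X ψ → fv X [ ψ / X ] ≡ ψ
fv-[/]-self X ψ rewrite dec-true (X ℕ.≟ X) refl = refl

fv-[/]-other : ∀ X {Z} ψ → X ≢ Z → fv Z [ ψ / X ] ≡ fv Z
fv-[/]-other X {Z} ψ X≢Z rewrite dec-false (X ℕ.≟ Z) X≢Z = refl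

μ-[/]-self : ∀ X φ ψ → μ X φ [ ψ / X ] ≡ μ X φ
μ-[/]-self X φ ψ rewrite dec-true (X ℕ.≟ X) refl = refl

μ-[/]-other : ∀ X {Z} φ ψ → X ≢ Z → μ Z φ [ ψ / X ] ≡ μ Z (φ [ ψ / X ])
μ-[/]-other X {Z} φ ψ X≢Z rewrite dec-false (X ℕ.≟ Z) X≢Z = refl

Scoped-⊆ : ∀ {vs ws φ} → vs ⊆ ws → Scoped vs φ → Scoped ws φ
Scoped-⊆ vs⊆ws st = st
Scoped-⊆ vs⊆ws rel = rel
Scoped-⊆ vs⊆ws (fv X∈vs) = fv (vs⊆ws X∈vs)
Scoped-⊆ vs⊆ws (and a b) = and (Scoped-⊆ vs⊆ws a) (Scoped-⊆ vs⊆ws b)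
Scoped-⊆ vs⊆ws (or a b) = or (Scoped-⊆ vs⊆ws a) (Scoped-⊆ vs⊆ws b)
Scoped-⊆ vs⊆ws (chp a b) = chp (Scoped-⊆ vs⊆ws a) (Scoped-⊆ vs⊆ws b)
Scoped-⊆ vs⊆ws (mu a) = mu (Scoped-⊆ (∷⁺ʳ _ vs⊆ws) a)

[/]-fresh : ∀ {vs φ} X ψ → Scoped vs φ → X ∉ vs → φ [ ψ / X ] ≡ φ
[/]-fresh X ψ st X∉vs = refl
[/]-fresh X ψ rel X∉vs = refl
[/]-fresh X ψ (fv Z∈vs) X∉vs = fv-[/]-other X ψ (λ { refl → X∉vs Z∈vs })
[/]-fresh X ψ (and a b) X∉vs = cong₂ _∧ᶠ_ ([/]-fresh X ψ a X∉vs) ([/]-fresh X ψ b X∉vs)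
[/]-fresh X ψ (or a b) X∉vs = cong₂ _∨ᶠ_ ([/]-fresh X ψ a X∉vs) ([/]-fresh X ψ b X∉vs)
[/]-fresh X ψ (chp a b) X∉vs = cong₂ _⁀ᶠ_ ([/]-fresh X ψ a X∉vs) ([/]-fresh X ψ b X∉vs)
[/]-fresh X ψ (mu {Z} {φ} a) X∉vs with X ℕ.≟ Z
... | yes refl = μ-[/]-self X φ ψ
... | no X≢Z = trans (μ-[/]-other X φ ψ X≢Z) (cong (μ Z) ([/]-fresh X ψ a X∉Z∷vs))
  where
  X∉Z∷vs : X ∉ Z ∷ _
  X∉Z∷vs (here X≡Z) = X≢Z X≡Z
  X∉Z∷vs (there X∈vs) = X∉vs X∈vs

[/]-closed : ∀ {φ} X ψ → Closed φ → φ [ ψ / X ] ≡ φ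
[/]-closed X ψ c = [/]-fresh X ψ c (λ ())

Id⁀→♯ : ∀ {ℓ} {A : TraceSet ℓ} {t} σA {s σB} →
        t ≡ σA ++⁺ (s ∷ σB) → ⟦ Id ⟧ (σA ∷ʳ s) → A (s ∷ σB) → ♯ A t
Id⁀→♯ (_ ∷ []) t≡ (rel refl) a = _ , _ , t≡ , a
Id⁀→♯ [] t≡ ()
Id⁀→♯ (_ ∷ _ ∷ []) t≡ ()
Id⁀→♯ (_ ∷ _ ∷ _ ∷ _) t≡ ()

guard-cases : ∀ b {φ t} → ⟦ φ ⟧ t → ⟦ ⌜ b ⌝ ∧ᶠ φ ⟧ t ⊎ ⟦ ⌜ ¬ₑ b ⌝ ∧ᶠ φ ⟧ t
guard-cases b {t = s ∷ _} d with ℬ⟦ b ⟧ s in b≡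
... | true = inj₁ (and (st b≡) d)
... | false = inj₂ (and (st (cong not b≡)) d)

ifᶠ : BExp → Formula → Formula → Formula
ifᶠ b φ₁ φ₂ = (⌜ b ⌝ ∧ᶠ (Id ⁀ᶠ φ₁)) ∨ᶠ (⌜ ¬ₑ b ⌝ ∧ᶠ (Id ⁀ᶠ φ₂))

ifᶠ-then : ∀ b φ₁ φ₂ → (Id ⁀ᶠ φ₁) ⊨ (⌜ ¬ₑ b ⌝ ∨ᶠ ifᶠ b φ₁ φ₂)
ifᶠ-then b φ₁ φ₂ t d with guard-cases b d
... | inj₁ taken = orr (orl taken)
... | inj₂ (and ¬b _) = orl ¬b

ifᶠ-else : ∀ b φ₁ φ₂ → (Id ⁀ᶠ φ₂) ⊨ (⌜ b ⌝ ∨ᶠ ifᶠ b φ₁ φ₂)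
ifᶠ-else b φ₁ φ₂ t d with guard-cases b d
... | inj₁ (and b _) = orl b
... | inj₂ taken = orr (orr taken)

Repl-[] : ∀ {k} {S S′ : Stmt k} → Repl (Assumed {k} []) S S′ → S′ ≡ S
Repl-[] skip = refl
Repl-[] asg = refl
Repl-[] (seq r₁ r₂) = cong₂ _；_ (Repl-[] r₁) (Repl-[] r₂)
Repl-[] (ite r₁ r₂) = cong₂ (IF_THEN_ELSE_ _) (Repl-[] r₁) (Repl-[] r₂)
Repl-[] (callY (_ , ()))
Repl-[] (callN _) = refl
Repl-[] var = refl

module _ {k : ℕ} (T : Table k) where

  open import Data.List.Membership.DecPropositional (_≟_ {k}) using (_∈?_)

  -- Calls of procedures assumed in Γ are derived in their replaced form skip ； Y m,
  -- as in the premise of (Call).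
  Derivable : Ctx k → Stmt k → Formula → Set₁
  Derivable Γ S φ = Σ (Stmt k) λ S′ → Repl (Assumed Γ) S S′ × T ⨾ Γ ⊢ S′ ∶ φ

  Derivable-[] : ∀ {S φ} → Derivable [] S φ → T ⨾ [] ⊢ S ∶ φ
  Derivable-[] {φ = φ} (S′ , rep , d) = subst (λ S → T ⨾ [] ⊢ S ∶ φ) (Repl-[] rep) d

  Derivable-seq : ∀ {Γ S₁ S₂ φ₁ φ₂} → Derivable Γ S₁ φ₁ → Derivable Γ S₂ φ₂ →
                  Derivable Γ (S₁ ； S₂) (φ₁ ⁀ᶠ φ₂)
  Derivable-seq (S₁′ , r₁ , d₁) (S₂′ , r₂ , d₂) = S₁′ ； S₂′ , seq r₁ r₂ , Seq d₁ d₂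

  Derivable-if : ∀ {Γ b S₁ S₂ φ₁ φ₂} → Closed φ₁ → Closed φ₂ →
                 Derivable Γ S₁ φ₁ → Derivable Γ S₂ φ₂ →
                 Derivable Γ (IF b THEN S₁ ELSE S₂) (ifᶠ b φ₁ φ₂)
  Derivable-if {b = b} {φ₁ = φ₁} {φ₂} c₁ c₂ (S₁′ , r₁ , d₁) (S₂′ , r₂ , d₂) =
    IF b THEN S₁′ ELSE S₂′ , ite r₁ r₂ ,
    If (Cons (chp rel c₁) (ifᶠ-then b φ₁ φ₂) (Seq Skip d₁))
       (Cons (chp rel c₂) (ifᶠ-else b φ₁ φ₂) (Seq Skip d₂))

  Derivable-assumed-call : ∀ {Γ m φ} → (m , φ) ∈ Γ → Derivable Γ (call m) (Id ⁀ᶠ φ)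
  Derivable-assumed-call {m = m} m∶φ∈Γ = skip ； Y m , callY (_ , m∶φ∈Γ) , Seq Skip (Ax m∶φ∈Γ)

  Derivable-rec-call : ∀ {Γ m X φ} → Closed (μ X φ) → ¬ Assumed Γ m →
                       Derivable ((m , μ X φ) ∷ Γ) (T m) (φ [ μ X φ / X ]) →
                       Derivable Γ (call m) (Id ⁀ᶠ μ X φ)
  Derivable-rec-call {m = m} closed m∉Γ (S′ , rep , d) =
    call m , callN m∉Γ , Call closed (λ m∈Γ → m∉Γ (_ , m∈Γ)) rep (Unfold d)

  Env : Set₁
  Env = Fin k → Formula

  _[_≔_]ᴱ : Env → Fin k → Formula → Env
  (E [ m ≔ φ ]ᴱ) x = if does (x ≟ m) then φ else E x

  _∖_ : List (Fin k) → Fin k → List (Fin k)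
  R ∖ m = filter (λ x → ¬? (x ≟ m)) R

  ∈-∖⁻ : ∀ {x m} R → x ∈ R ∖ m → x ∈ R × x ≢ m
  ∈-∖⁻ R = ∈-filter⁻ (λ x → ¬? (x ≟ _)) {xs = R}

  ∉-∖ : ∀ {x m R} → x ∉ R ∖ m → x ≢ m → x ∉ R
  ∉-∖ x∉R∖m x≢m x∈R = x∉R∖m (∈-filter⁺ (λ x → ¬? (x ≟ _)) x∈R x≢m)

  length-∖ : ∀ {m R} → m ∈ R → length (R ∖ m) ℕ.< length R
  length-∖ {m} {R} m∈R =
    filter-notAll (λ x → ¬? (x ≟ m)) R (Any.map (λ m≡x x≢m → x≢m (sym m≡x)) m∈R)

  ⊥ᶠ : Formula
  ⊥ᶠ = st (λ _ → ⊥)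

  -- E supplies the formula of every procedure outside R (the procedures assumed so far);
  -- a call of m ∈ R is unfolded into a μ-formula with fixpoint variable X_m = toℕ m.  The
  -- fuel n bounds the nesting of unfoldings; ⊥ᶠ is a junk value, never reached for
  -- statements without statement variables and fuel length R ≤ n.
  mutual
    χ : ℕ → Env → List (Fin k) → Stmt k → Formula
    χ n E R skip = Id
    χ n E R (x ≔ a) = Sb x a
    χ n E R (S₁ ； S₂) = χ n E R S₁ ⁀ᶠ χ n E R S₂
    χ n E R (IF b THEN S₁ ELSE S₂) = ifᶠ b (χ n E R S₁) (χ n E R S₂)
    χ n E R (call m) = Id ⁀ᶠ χ-proc n E R m (m ∈? R)
    χ n E R (Y m) = ⊥ᶠ

    χ-proc : ℕ → Env → (R : List (Fin k)) (m : Fin k) → Dec (m ∈ R) → Formula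
    χ-proc n E R m (no _) = E m
    χ-proc zero E R m (yes _) = ⊥ᶠ
    χ-proc (suc n) E R m (yes _) = χ-μ n E R m

    χ-μ : ℕ → Env → List (Fin k) → Fin k → Formula
    χ-μ n E R m = μ (toℕ m) (χ n (E [ m ≔ fv (toℕ m) ]ᴱ) (R ∖ m) (T m))

  mutual
    χ-scoped : ∀ {vs} n E R S → (∀ x → x ∉ R → Scoped vs (E x)) → Scoped vs (χ n E R S)
    χ-scoped n E R skip h = rel
    χ-scoped n E R (x ≔ a) h = rel
    χ-scoped n E R (S₁ ； S₂) h = chp (χ-scoped n E R S₁ h) (χ-scoped n E R S₂ h)
    χ-scoped n E R (IF b THEN S₁ ELSE S₂) h =
      or (and st (chp rel (χ-scoped n E R S₁ h))) (and st (chp rel (χ-scoped n E R S₂ h)))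
    χ-scoped n E R (call m) h = chp rel (χ-proc-scoped n E R m (m ∈? R) h)
    χ-scoped n E R (Y m) h = st

    χ-proc-scoped : ∀ {vs} n E R m m∈?R → (∀ x → x ∉ R → Scoped vs (E x)) →
                    Scoped vs (χ-proc n E R m m∈?R)
    χ-proc-scoped n E R m (no m∉R) h = h m m∉R
    χ-proc-scoped zero E R m (yes _) h = st
    χ-proc-scoped (suc n) E R m (yes _) h = χ-μ-scoped n E R m h

    χ-μ-scoped : ∀ {vs} n E R m → (∀ x → x ∉ R → Scoped vs (E x)) → Scoped vs (χ-μ n E R m)
    χ-μ-scoped {vs} n E R m h = mu (χ-scoped n _ (R ∖ m) (T m) h′)
      where
      h′ : ∀ x → x ∉ R ∖ m → Scoped (toℕ m ∷ vs) ((E [ m ≔ fv (toℕ m) ]ᴱ) x)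
      h′ x x∉R∖m with x ≟ m
      ... | yes refl = fv (here refl)
      ... | no x≢m = Scoped-⊆ (xs⊆x∷xs vs (toℕ m)) (h x (∉-∖ x∉R∖m x≢m))

  mutual
    χ-[/] : ∀ {X ψ} n E E′ R S → (∀ x → x ∈ R → toℕ x ≢ X) →
            (∀ x → x ∉ R → E′ x ≡ E x [ ψ / X ]) → χ n E R S [ ψ / X ] ≡ χ n E′ R S
    χ-[/] n E E′ R skip fresh h = refl
    χ-[/] n E E′ R (x ≔ a) fresh h = refl
    χ-[/] n E E′ R (S₁ ； S₂) fresh h =
      cong₂ _⁀ᶠ_ (χ-[/] n E E′ R S₁ fresh h) (χ-[/] n E E′ R S₂ fresh h)
    χ-[/] n E E′ R (IF b THEN S₁ ELSE S₂) fresh h =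
      cong₂ (ifᶠ b) (χ-[/] n E E′ R S₁ fresh h) (χ-[/] n E E′ R S₂ fresh h)
    χ-[/] n E E′ R (call m) fresh h = cong (Id ⁀ᶠ_) (χ-proc-[/] n E E′ R m (m ∈? R) fresh h)
    χ-[/] n E E′ R (Y m) fresh h = refl

    χ-proc-[/] : ∀ {X ψ} n E E′ R m m∈?R → (∀ x → x ∈ R → toℕ x ≢ X) →
                 (∀ x → x ∉ R → E′ x ≡ E x [ ψ / X ]) →
                 χ-proc n E R m m∈?R [ ψ / X ] ≡ χ-proc n E′ R m m∈?R
    χ-proc-[/] n E E′ R m (no m∉R) fresh h = sym (h m m∉R)
    χ-proc-[/] zero E E′ R m (yes _) fresh h = refl
    χ-proc-[/] {X} {ψ} (suc n) E E′ R m (yes m∈R) fresh h =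
      trans (μ-[/]-other X _ ψ X≢m) (cong (μ (toℕ m)) (χ-[/] n _ _ (R ∖ m) (T m) fresh′ h′))
      where
      X≢m : X ≢ toℕ m
      X≢m X≡m = fresh m m∈R (sym X≡m)
      fresh′ : ∀ x → x ∈ R ∖ m → toℕ x ≢ X
      fresh′ x x∈R∖m = fresh x (proj₁ (∈-∖⁻ R x∈R∖m))
      h′ : ∀ x → x ∉ R ∖ m → (E′ [ m ≔ fv (toℕ m) ]ᴱ) x ≡ (E [ m ≔ fv (toℕ m) ]ᴱ) x [ ψ / X ]
      h′ x x∉R∖m with x ≟ m
      ... | yes refl = sym (fv-[/]-other X ψ X≢m)
      ... | no x≢m = h x (∉-∖ x∉R∖m x≢m)

  -- Procedure formulas are tracked by their syntactic origin rather than by their meaning: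
  -- soundness of χ-μ n E R m for T m is exactly what is being proved, and unfolding the μ
  -- keeps that proof structural in the derivation of ⟦ χ-μ n E R m ⟧ u.
  data RecFormula : Fin k → Formula → Set₁ where
    rec : ∀ {n E R m} → (∀ x → x ∉ R → RecFormula x (E x)) → RecFormula m (χ-μ n E R m)

  Admissible : Env → List (Fin k) → Set₁
  Admissible E R = ∀ x → x ∉ R → RecFormula x (E x)

  RecFormula-closed : ∀ {m ψ} → RecFormula m ψ → Closed ψ
  RecFormula-closed (rec {n} {E} {R} {m} adm) =
    χ-μ-scoped n E R m (λ x x∉R → RecFormula-closed (adm x x∉R))

  χ-closed : ∀ {E R} n S → Admissible E R → Closed (χ n E R S)
  χ-closed {E} {R} n S adm = χ-scoped n E R S (λ x x∉R → RecFormula-closed (adm x x∉R))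

  admissible-bind : ∀ {n E R} m → Admissible E R → Admissible (E [ m ≔ χ-μ n E R m ]ᴱ) (R ∖ m)
  admissible-bind m adm x x∉R∖m with x ≟ m
  ... | yes refl = rec adm
  ... | no x≢m = adm x (∉-∖ x∉R∖m x≢m)

  χ-μ-unfold : ∀ n E R m → Admissible E R →
               χ n (E [ m ≔ fv (toℕ m) ]ᴱ) (R ∖ m) (T m) [ χ-μ n E R m / toℕ m ]
                 ≡ χ n (E [ m ≔ χ-μ n E R m ]ᴱ) (R ∖ m) (T m)
  χ-μ-unfold n E R m adm = χ-[/] n _ _ (R ∖ m) (T m) fresh h
    where
    fresh : ∀ x → x ∈ R ∖ m → toℕ x ≢ toℕ m
    fresh x x∈R∖m x≡m = proj₂ (∈-∖⁻ R x∈R∖m) (toℕ-injective x≡m)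
    h : ∀ x → x ∉ R ∖ m →
        (E [ m ≔ χ-μ n E R m ]ᴱ) x ≡ (E [ m ≔ fv (toℕ m) ]ᴱ) x [ χ-μ n E R m / toℕ m ]
    h x x∉R∖m with x ≟ m
    ... | yes refl = sym (fv-[/]-self (toℕ m) _)
    ... | no x≢m = sym ([/]-closed (toℕ m) _ (RecFormula-closed (adm x (∉-∖ x∉R∖m x≢m))))

  -- The formula is related to χ by an equation rather than given as χ n E R S, so that the
  -- recursion stays structural on the derivation of ⟦ φ ⟧ t even after rewriting by χ-μ-unfold.
  mutual
    χ-sound : ∀ n E R S {φ t} → φ ≡ χ n E R S → ⟦ φ ⟧ t → Admissible E R → 𝒮tr⟦ T ⟧ S t
    χ-sound n E R skip refl (rel refl) adm = skip
    χ-sound n E R (x ≔ a) refl (rel refl) adm = asg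
    χ-sound n E R (S₁ ； S₂) refl (chp (σA , s , σB , t≡ , d₁ , d₂)) adm =
      seq (σA , s , σB , t≡ , χ-sound n E R S₁ refl d₁ adm , χ-sound n E R S₂ refl d₂ adm)
    χ-sound n E R (IF b THEN S₁ ELSE S₂) refl
            (orl (and (st b≡) (chp (σA , _ , _ , t≡ , dId , d₁)))) adm =
      ifT (Id⁀→♯ σA t≡ dId (χ-sound n E R S₁ refl d₁ adm) , b≡)
    χ-sound n E R (IF b THEN S₁ ELSE S₂) refl
            (orr (and (st ¬b≡) (chp (σA , _ , _ , t≡ , dId , d₂)))) adm =
      ifF (Id⁀→♯ σA t≡ dId (χ-sound n E R S₂ refl d₂ adm) , ¬b≡)
    χ-sound n E R (call m) refl (chp (σA , _ , _ , t≡ , dId , d)) adm =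
      call (Id⁀→♯ σA t≡ dId (χ-proc-sound n E R m (m ∈? R) d adm))
    χ-sound n E R (Y m) refl (st ()) adm

    χ-proc-sound : ∀ n E R m m∈?R {u} → ⟦ χ-proc n E R m m∈?R ⟧ u → Admissible E R →
                   𝒮tr⟦ T ⟧ (T m) u
    χ-proc-sound n E R m (no m∉R) d adm = RecFormula-sound (adm m m∉R) d
    χ-proc-sound zero E R m (yes _) (st ()) adm
    χ-proc-sound (suc n) E R m (yes _) d adm = RecFormula-sound (rec {n} {E} {R} {m} adm) d

    RecFormula-sound : ∀ {m ψ u} → RecFormula m ψ → ⟦ ψ ⟧ u → 𝒮tr⟦ T ⟧ (T m) u
    RecFormula-sound {m} (rec {n} {E} {R} adm) (mu d) =
      χ-sound n _ (R ∖ m) (T m) (χ-μ-unfold n E R m adm) d (admissible-bind m adm)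

  record Assumes (Γ : Ctx k) (E : Env) (R : List (Fin k)) : Set₁ where
    field
      assumed   : ∀ x → x ∉ R → (x , E x) ∈ Γ
      unassumed : ∀ x → x ∈ R → ¬ Assumed Γ x

  open Assumes

  Assumes-bind : ∀ {Γ E R} m φ → Assumes Γ E R → Assumes ((m , φ) ∷ Γ) (E [ m ≔ φ ]ᴱ) (R ∖ m)
  Assumes-bind m φ asm .assumed x x∉R∖m with x ≟ m
  ... | yes refl = here refl
  ... | no x≢m = there (asm .assumed x (∉-∖ x∉R∖m x≢m))
  Assumes-bind {R = R} m φ asm .unassumed x x∈R∖m (_ , here refl) = proj₂ (∈-∖⁻ R x∈R∖m) refl
  Assumes-bind {R = R} m φ asm .unassumed x x∈R∖m (ψ , there x∶ψ∈Γ) =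
    asm .unassumed x (proj₁ (∈-∖⁻ R x∈R∖m)) (ψ , x∶ψ∈Γ)

  mutual
    χ-derivable : (∀ m → NoSVar (T m)) → ∀ n E R Γ S → NoSVar S → length R ≤ n →
                  Admissible E R → Assumes Γ E R → Derivable Γ S (χ n E R S)
    χ-derivable noT n E R Γ skip skip fuel adm asm = skip , skip , Skip
    χ-derivable noT n E R Γ (x ≔ a) asg fuel adm asm = x ≔ a , asg , Assign
    χ-derivable noT n E R Γ (S₁ ； S₂) (seq noS₁ noS₂) fuel adm asm =
      Derivable-seq (χ-derivable noT n E R Γ S₁ noS₁ fuel adm asm)
                    (χ-derivable noT n E R Γ S₂ noS₂ fuel adm asm)
    χ-derivable noT n E R Γ (IF b THEN S₁ ELSE S₂) (ite noS₁ noS₂) fuel adm asm =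
      Derivable-if (χ-closed n S₁ adm) (χ-closed n S₂ adm)
                   (χ-derivable noT n E R Γ S₁ noS₁ fuel adm asm)
                   (χ-derivable noT n E R Γ S₂ noS₂ fuel adm asm)
    χ-derivable noT n E R Γ (call m) call fuel adm asm =
      χ-call-derivable noT n E R Γ m (m ∈? R) fuel adm asm

    χ-call-derivable : (∀ m → NoSVar (T m)) → ∀ n E R Γ m m∈?R → length R ≤ n →
                       Admissible E R → Assumes Γ E R →
                       Derivable Γ (call m) (Id ⁀ᶠ χ-proc n E R m m∈?R)
    χ-call-derivable noT n E R Γ m (no m∉R) fuel adm asm =
      Derivable-assumed-call (asm .assumed m m∉R)
    χ-call-derivable noT zero E (_ ∷ _) Γ m (yes _) () adm asm
    χ-call-derivable noT (suc n) E R Γ m (yes m∈R) fuel adm asm =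
      Derivable-rec-call (RecFormula-closed (rec {n} {E} {R} {m} adm)) (asm .unassumed m m∈R)
        (subst (Derivable _ (T m)) (sym (χ-μ-unfold n E R m adm))
          (χ-derivable noT n _ (R ∖ m) _ (T m) (noT m) (s≤s⁻¹ (≤-trans (length-∖ m∈R) fuel))
            (admissible-bind m adm) (Assumes-bind m (χ-μ n E R m) asm)))

mainTheorem7 : {k : ℕ} (T : Table k) → (∀ m → NoSVar (T m)) →
    (S : Stmt k) → NoSVar S → (φ : Formula) → Closed φ →
    (∀ t → 𝒮tr⟦ T ⟧ S t → ⟦ φ ⟧ t) →
    T ⨾ [] ⊢ S ∶ φ
mainTheorem7 {k} T noT S noS φ _ valid =
  Cons (χ-closed T n₀ S adm₀) (λ t d → valid t (χ-sound T n₀ E₀ R₀ S refl d adm₀))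
    (Derivable-[] T (χ-derivable T noT n₀ E₀ R₀ [] S noS ≤-refl adm₀ asm₀))
  where
  R₀ = allFin k
  n₀ = length R₀
  E₀ : Env T
  E₀ = const (⊥ᶠ T)
  adm₀ : Admissible T E₀ R₀
  adm₀ x x∉R₀ = contradiction (∈-allFin x) x∉R₀
  asm₀ : Assumes T [] E₀ R₀
  asm₀ = record { assumed = λ x x∉R₀ → contradiction (∈-allFin x) x∉R₀ ; unassumed = λ _ _ () }
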